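{- Let $G$ be a finite simple graph and let $A \subseteq V(G)$ be a non-empty set such that the induced subgraph $G[A]$ is connected. Then for each integer $r \geq 1$, the simplicial complex $\Sigma_r(A,G)$ is vertex decomposable.
   Context: For a finite simple graph $G$, a positive integer $r$ and $A\subseteq V(G)$, the $r$-support of $A$ is $\mathrm{Supp}_r(A,G)=\{F\subseteq V(G): |F|=r,\ F\cap A=\emptyset,\ G[F\cup A]\text{ is connected}\}$. The $r$-co-connected complex of $G$ with respect to $A$ is the simplicial complex $\Sigma_r(A,G)=\langle F^c\setminus A : F\in \mathrm{Supp}_r(A,G)\rangle$ generated by these sets, where $F^c=V(G)\setminus F$ (if $\mathrm{Supp}_r(A,G)=\emptyset$ it is the void complex, i.e. the complex with no faces). A simplicial complex $\Delta$ is vertex decomposable if it is a simplex, or the empty complex $\{\emptyset\}$, or the void complex, or there is a vertex $x$ such that $\mathrm{lk}_\Delta(x)=\{H\in\Delta: x\notin H,\ H\cup\{x\}\in\Delta\}$ and $\mathrm{del}_\Delta(x)=\{H\in\Delta : x\notin H\}$ are vertex decomposable and every facet of $\mathrm{del}_\Delta(x)$ is a facet of $\Delta$. -}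

module Defs where

open import Level using (0ℓ)
open import Data.Nat using (ℕ; _≤_)
open import Data.Bool using (Bool; true; false)
open import Data.Fin using (Fin)
open import Data.Fin.Subset public
  using (Subset; _∈_; _∉_; _⊆_; ∁; _∩_; _∪_; _─_; ∣_∣; ⁅_⁆; Nonempty)
  renaming (⊥ to ∅)
open import Data.Product using (Σ; ∃; _×_; _,_)
open import Relation.Binary.PropositionalEquality using (_≡_)
open import Relation.Nullary using (¬_)
open import Function.Bundles using (_⇔_)

record Graph (n : ℕ) : Set where
  field
    adj     : Fin n → Fin n → Bool
    adj-sym : ∀ x y → adj x y ≡ adj y x
    adj-irr : ∀ x → adj x x ≡ false
open Graph public

data Walk {n : ℕ} (G : Graph n) (S : Subset n) : Fin n → Fin n → Set where
  here : ∀ {x} → x ∈ S → Walk G S x x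
  step : ∀ {x z y} → x ∈ S → adj G x z ≡ true → Walk G S z y → Walk G S x y

Connected : {n : ℕ} → Graph n → Subset n → Set
Connected G S = Nonempty S × (∀ x y → x ∈ S → y ∈ S → Walk G S x y)

Supp : {n : ℕ} → ℕ → Subset n → Graph n → Subset n → Set
Supp r A G F = (∣ F ∣ ≡ r) × (F ∩ A ≡ ∅) × Connected G (F ∪ A)

Complex : ℕ → Set₁
Complex n = Subset n → Set

-- Complex generated by the sets F^c \ A, F ∈ Supp_r(A,G)
-- (void complex if the support is empty).
CoConnected : {n : ℕ} → ℕ → Subset n → Graph n → Complex n
CoConnected r A G H = Σ (Subset _) λ F → Supp r A G F × (H ⊆ (∁ F ─ A))

link : {n : ℕ} → Complex n → Fin n → Complex n
link Δ x H = (x ∉ H) × Δ (H ∪ ⁅ x ⁆)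

deletion : {n : ℕ} → Complex n → Fin n → Complex n
deletion Δ x H = (x ∉ H) × Δ H

IsFacet : {n : ℕ} → Complex n → Subset n → Set
IsFacet Δ H = Δ H × (∀ K → Δ K → H ⊆ K → H ≡ K)

IsSimplex : {n : ℕ} → Complex n → Set
IsSimplex Δ = ∃ λ σ → ∀ H → (Δ H ⇔ (H ⊆ σ))

IsEmptyComplex : {n : ℕ} → Complex n → Set
IsEmptyComplex Δ = ∀ H → (Δ H ⇔ (H ≡ ∅))

IsVoid : {n : ℕ} → Complex n → Set
IsVoid Δ = ∀ H → ¬ Δ H

data VertexDecomposable {n : ℕ} (Δ : Complex n) : Set₁ where
  simplex : IsSimplex Δ → VertexDecomposable Δ
  empty   : IsEmptyComplex Δ → VertexDecomposable Δ
  void    : IsVoid Δ → VertexDecomposable Δ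
  shed    : (x : Fin n) → Δ ⁅ x ⁆
          → VertexDecomposable (link Δ x)
          → VertexDecomposable (deletion Δ x)
          → (∀ H → IsFacet (deletion Δ x) H → IsFacet Δ H)
          → VertexDecomposable Δ

-- Generalise Σ_r(A,G) to Σ≥_r(A,B): supports of size at least r in G ∖ B, faces
-- avoiding B.  For r = 0 it is the simplex on V ∖ (A ∪ B).  For r > 0, either no
-- vertex outside A ∪ B is adjacent to A and the complex is void, or such a vertex x
-- sheds: its link is Σ≥_r(A, B ∪ {x}) and its deletion Σ≥_{r-1}(A ∪ {x}, B), both
-- vertex decomposable by induction on |V ∖ (A ∪ B)|.  Beside a connected A, a
-- support can be shrunk to a connected subsupport of any smaller size; this shows
-- that facets of the deletion are facets, and that Σ≥_r(A,∅) = Σ_r(A,G).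
module Submission where

open import Defs
open import Algebra.Bundles using (CommutativeMonoid)
import Algebra.Properties.CommutativeSemigroup as CommutativeSemigroupProperties
open import Data.Bool using (true)
import Data.Bool as Bool
open import Data.Empty using (⊥-elim)
open import Data.Fin using (Fin; zero; suc)
open import Data.Fin.Properties using (any?)
open import Data.Fin.Subset using (inside; outside; _-_)
open import Data.Fin.Subset.Properties
  using (x∈⁅x⁆; x∈⁅y⁆⇒x≡y; ∉⊥; ⊥⊆; ∣⊥∣≡0; ∣p∣≤n; _∈?_; p⊆q⇒∣p∣≤∣q∣; p⊂q⇒∣p∣<∣q∣;
         p⊂q⇒∁p⊃∁q; x∈∁p⇒x∉p; x∉p⇒x∈∁p; x∈p∩q⁺; x∈p∩q⁻; ⊆-antisym; p⊆p∪q; q⊆p∪q;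
         x∈p∪q⁻; ∣p∣≤∣p∪q∣; p─⊥≡p; x∈p∧x∉q⇒x∈p─q; p─q⊆p; ∪-assoc;
         ∪-identityˡ; ∪-identityʳ; ∪-commutativeMonoid)
open import Data.Nat using (ℕ; zero; suc; _≤_; _<_; z≤n; s≤s; s≤s⁻¹)
open import Data.Nat.Properties
  using (≤-trans; ≤-reflexive; <⇒≤; <⇒≱; <-≤-trans; module ≤-Reasoning)
open import Data.Product using (∃; ∃₂; _×_; _,_; proj₁; proj₂; map₂)
open import Data.Sum using (inj₁; inj₂; [_,_])
open import Data.Vec using (_∷_; here; there)
open import Function using (_∘_; id)
open import Function.Bundles using (_⇔_; mk⇔; Equivalence)
import Function.Properties.Equivalence as ⇔
open import Relation.Nullary using (¬_; Dec; yes; no; ¬?)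
open import Relation.Nullary.Decidable using (_×-dec_; map′; decidable-stable)
open import Relation.Binary.PropositionalEquality
  using (_≡_; refl; sym; trans; subst; cong; module ≡-Reasoning)

open Equivalence using (to; from)

module _ {n : ℕ} where

  Disjoint : Subset n → Subset n → Set
  Disjoint p q = ∀ {i} → i ∈ p → i ∉ q

  x∉p∪q : ∀ {x} (p q : Subset n) → x ∉ p → x ∉ q → x ∉ p ∪ q
  x∉p∪q p q x∉p x∉q = [ x∉p , x∉q ] ∘ x∈p∪q⁻ p q

  ∪⊆ : ∀ {p q r : Subset n} → p ⊆ r → q ⊆ r → p ∪ q ⊆ r
  ∪⊆ {p} {q} p⊆r q⊆r = [ p⊆r , q⊆r ] ∘ x∈p∪q⁻ p q

  ⁅x⁆⊆p : ∀ {x} {p : Subset n} → x ∈ p → ⁅ x ⁆ ⊆ p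
  ⁅x⁆⊆p {x} {p} x∈p i∈⁅x⁆ = subst (_∈ p) (sym (x∈⁅y⁆⇒x≡y x i∈⁅x⁆)) x∈p

  ∪-monoˡ-⊆ : ∀ {p q} (r : Subset n) → p ⊆ q → p ∪ r ⊆ q ∪ r
  ∪-monoˡ-⊆ {q = q} r p⊆q = ∪⊆ (p⊆p∪q r ∘ p⊆q) (q⊆p∪q q r)

  Disjoint-monoˡ : ∀ {p p′ q : Subset n} → p ⊆ p′ → Disjoint p′ q → Disjoint p q
  Disjoint-monoˡ p⊆p′ p′#q = p′#q ∘ p⊆p′

  Disjoint-monoʳ : ∀ {p q q′ : Subset n} → q ⊆ q′ → Disjoint p q′ → Disjoint p q
  Disjoint-monoʳ q⊆q′ p#q′ i∈p = p#q′ i∈p ∘ q⊆q′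

  Disjoint-∪ˡ : ∀ {p q r : Subset n} → Disjoint p r → Disjoint q r → Disjoint (p ∪ q) r
  Disjoint-∪ˡ {p} {q} p#r q#r = [ p#r , q#r ] ∘ x∈p∪q⁻ p q

  Disjoint-∪ʳ : ∀ {p q r : Subset n} → Disjoint p q → Disjoint p r → Disjoint p (q ∪ r)
  Disjoint-∪ʳ {q = q} {r} p#q p#r i∈p = x∉p∪q q r (p#q i∈p) (p#r i∈p)

  Disjoint-⁅⁆ˡ : ∀ {x} {p : Subset n} → x ∉ p → Disjoint ⁅ x ⁆ p
  Disjoint-⁅⁆ˡ {x} {p} x∉p i∈⁅x⁆ = x∉p ∘ subst (_∈ p) (x∈⁅y⁆⇒x≡y x i∈⁅x⁆)

  Disjoint-⁅⁆ʳ : ∀ {x} {p : Subset n} → x ∉ p → Disjoint p ⁅ x ⁆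
  Disjoint-⁅⁆ʳ x∉p i∈p i∈⁅x⁆ = Disjoint-⁅⁆ˡ x∉p i∈⁅x⁆ i∈p

  Disjoint-∅ˡ : ∀ {p : Subset n} → Disjoint ∅ p
  Disjoint-∅ˡ i∈∅ = ⊥-elim (∉⊥ i∈∅)

  Disjoint-∅ʳ : ∀ {p : Subset n} → Disjoint p ∅
  Disjoint-∅ʳ _ = ∉⊥

  Disjoint-∁ : ∀ {p : Subset n} → Disjoint (∁ p) p
  Disjoint-∁ = x∈∁p⇒x∉p

  Disjoint⇒⊆∁ : ∀ {p q : Subset n} → Disjoint p q → p ⊆ ∁ q
  Disjoint⇒⊆∁ p#q = x∉p⇒x∈∁p ∘ p#q

  ⊆∁⇒Disjoint : ∀ {p q : Subset n} → p ⊆ ∁ q → Disjoint p q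
  ⊆∁⇒Disjoint p⊆∁q = x∈∁p⇒x∉p ∘ p⊆∁q

  Disjoint⇒∩≡∅ : ∀ {p q : Subset n} → Disjoint p q → p ∩ q ≡ ∅
  Disjoint⇒∩≡∅ {p} {q} p#q =
    ⊆-antisym (λ i∈p∩q → let i∈p , i∈q = x∈p∩q⁻ p q i∈p∩q in ⊥-elim (p#q i∈p i∈q)) ⊥⊆

  ∩≡∅⇒Disjoint : ∀ {p q : Subset n} → p ∩ q ≡ ∅ → Disjoint p q
  ∩≡∅⇒Disjoint {p} {q} p∩q≡∅ i∈p i∈q = ∉⊥ (subst (_ ∈_) p∩q≡∅ (x∈p∩q⁺ (i∈p , i∈q)))

Disjoint-─ : ∀ {n} (p q : Subset n) → Disjoint (p ─ q) q
Disjoint-─ (_ ∷ p) (inside ∷ q) {zero} () here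
Disjoint-─ (_ ∷ p) (_ ∷ q) {suc i} (there i∈p─q) (there i∈q) = Disjoint-─ p q i∈p─q i∈q

∣p∪⁅x⁆∣≡1+∣p∣ : ∀ {n} (p : Subset n) x → x ∉ p → ∣ p ∪ ⁅ x ⁆ ∣ ≡ suc ∣ p ∣
∣p∪⁅x⁆∣≡1+∣p∣ (inside ∷ p) zero x∉p = ⊥-elim (x∉p here)
∣p∪⁅x⁆∣≡1+∣p∣ (outside ∷ p) zero _ = cong (suc ∘ ∣_∣) (∪-identityʳ p)
∣p∪⁅x⁆∣≡1+∣p∣ (inside ∷ p) (suc x) x∉p = cong suc (∣p∪⁅x⁆∣≡1+∣p∣ p x (x∉p ∘ there))
∣p∪⁅x⁆∣≡1+∣p∣ (outside ∷ p) (suc x) x∉p = ∣p∪⁅x⁆∣≡1+∣p∣ p x (x∉p ∘ there)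

p-x∪⁅x⁆≡p∪⁅x⁆ : ∀ {n} (p : Subset n) x → (p - x) ∪ ⁅ x ⁆ ≡ p ∪ ⁅ x ⁆
p-x∪⁅x⁆≡p∪⁅x⁆ (inside ∷ p) zero = cong (inside ∷_) (cong (_∪ ∅) (p─⊥≡p p))
p-x∪⁅x⁆≡p∪⁅x⁆ (outside ∷ p) zero = cong (inside ∷_) (cong (_∪ ∅) (p─⊥≡p p))
p-x∪⁅x⁆≡p∪⁅x⁆ (inside ∷ p) (suc x) = cong (inside ∷_) (p-x∪⁅x⁆≡p∪⁅x⁆ p x)
p-x∪⁅x⁆≡p∪⁅x⁆ (outside ∷ p) (suc x) = cong (outside ∷_) (p-x∪⁅x⁆≡p∪⁅x⁆ p x)

∣p∣≤1+∣p-x∣ : ∀ {n} (p : Subset n) x → ∣ p ∣ ≤ suc ∣ p - x ∣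
∣p∣≤1+∣p-x∣ p x = begin
  ∣ p ∣                ≤⟨ ∣p∣≤∣p∪q∣ p ⁅ x ⁆ ⟩
  ∣ p ∪ ⁅ x ⁆ ∣        ≡⟨ cong ∣_∣ (p-x∪⁅x⁆≡p∪⁅x⁆ p x) ⟨
  ∣ (p - x) ∪ ⁅ x ⁆ ∣  ≡⟨ ∣p∪⁅x⁆∣≡1+∣p∣ (p - x) x (λ x∈p-x → Disjoint-─ p ⁅ x ⁆ x∈p-x (x∈⁅x⁆ x)) ⟩
  suc ∣ p - x ∣        ∎
  where open ≤-Reasoning

∣p∣<∣q∣⇒∃x∈q∖p : ∀ {n} (p q : Subset n) → ∣ p ∣ < ∣ q ∣ → ∃ λ x → x ∈ q × x ∉ p
∣p∣<∣q∣⇒∃x∈q∖p p q ∣p∣<∣q∣ with any? (λ x → (x ∈? q) ×-dec ¬? (x ∈? p))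
... | yes x∈q∖p = x∈q∖p
... | no q⊆p = ⊥-elim (<⇒≱ ∣p∣<∣q∣ (p⊆q⇒∣p∣≤∣q∣ λ {x} x∈q →
                 decidable-stable (x ∈? p) (λ x∉p → q⊆p (x , x∈q , x∉p))))

∣∁[p∪⁅x⁆]∣<∣∁p∣ : ∀ {n} (p : Subset n) {x} → x ∉ p → ∣ ∁ (p ∪ ⁅ x ⁆) ∣ < ∣ ∁ p ∣
∣∁[p∪⁅x⁆]∣<∣∁p∣ p {x} x∉p =
  p⊂q⇒∣p∣<∣q∣ (p⊂q⇒∁p⊃∁q (p⊆p∪q ⁅ x ⁆ , x , q⊆p∪q p ⁅ x ⁆ (x∈⁅x⁆ x) , x∉p))

module _ {n : ℕ} where

  infix 4 _≃_
  _≃_ : Complex n → Complex n → Set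
  Δ ≃ Δ′ = ∀ H → Δ H ⇔ Δ′ H

  ≃-sym : ∀ {Δ Δ′ : Complex n} → Δ ≃ Δ′ → Δ′ ≃ Δ
  ≃-sym Δ≃Δ′ H = ⇔.sym (Δ≃Δ′ H)

  link-resp-≃ : ∀ {Δ Δ′ : Complex n} → Δ ≃ Δ′ → ∀ x → link Δ x ≃ link Δ′ x
  link-resp-≃ Δ≃Δ′ x H = mk⇔ (map₂ (to (Δ≃Δ′ _))) (map₂ (from (Δ≃Δ′ _)))

  deletion-resp-≃ : ∀ {Δ Δ′ : Complex n} → Δ ≃ Δ′ → ∀ x → deletion Δ x ≃ deletion Δ′ x
  deletion-resp-≃ Δ≃Δ′ x H = mk⇔ (map₂ (to (Δ≃Δ′ H))) (map₂ (from (Δ≃Δ′ H)))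

  IsFacet-resp-≃ : ∀ {Δ Δ′ : Complex n} → Δ ≃ Δ′ → ∀ {H} → IsFacet Δ H → IsFacet Δ′ H
  IsFacet-resp-≃ Δ≃Δ′ (ΔH , maximal) =
    to (Δ≃Δ′ _) ΔH , λ K Δ′K H⊆K → maximal K (from (Δ≃Δ′ K) Δ′K) H⊆K

  VertexDecomposable-resp-≃ : ∀ {Δ Δ′ : Complex n} → Δ ≃ Δ′
                            → VertexDecomposable Δ → VertexDecomposable Δ′
  VertexDecomposable-resp-≃ Δ≃Δ′ (simplex (σ , faces)) =
    simplex (σ , λ H → ⇔.trans (⇔.sym (Δ≃Δ′ H)) (faces H))
  VertexDecomposable-resp-≃ Δ≃Δ′ (empty faces) = empty λ H → ⇔.trans (⇔.sym (Δ≃Δ′ H)) (faces H)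
  VertexDecomposable-resp-≃ Δ≃Δ′ (void noFaces) = void λ H → noFaces H ∘ from (Δ≃Δ′ H)
  VertexDecomposable-resp-≃ Δ≃Δ′ (shed x Δx vdLink vdDeletion facets) =
    shed x (to (Δ≃Δ′ _) Δx)
      (VertexDecomposable-resp-≃ (link-resp-≃ Δ≃Δ′ x) vdLink)
      (VertexDecomposable-resp-≃ (deletion-resp-≃ Δ≃Δ′ x) vdDeletion)
      (λ H → IsFacet-resp-≃ Δ≃Δ′ ∘ facets H ∘ IsFacet-resp-≃ (≃-sym (deletion-resp-≃ Δ≃Δ′ x)))

  DownClosed : Complex n → Set
  DownClosed Δ = ∀ {H K} → K ⊆ H → Δ H → Δ K

  link-downClosed : ∀ {Δ} → DownClosed Δ → ∀ x → DownClosed (link Δ x)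
  link-downClosed down x K⊆H (x∉H , ΔH∪x) = x∉H ∘ K⊆H , down (∪-monoˡ-⊆ ⁅ x ⁆ K⊆H) ΔH∪x

  nonvoid? : ∀ {Δ} → DownClosed Δ → VertexDecomposable Δ → Dec (Δ ∅)
  nonvoid? down (simplex (σ , faces)) = yes (from (faces ∅) ⊥⊆)
  nonvoid? down (empty faces) = yes (from (faces ∅) refl)
  nonvoid? down (void noFaces) = no (noFaces ∅)
  nonvoid? down (shed x Δx _ _ _) = yes (down ⊥⊆ Δx)

  nonvertex⇒≃deletion : ∀ {Δ} → DownClosed Δ → ∀ x → ¬ Δ ⁅ x ⁆ → Δ ≃ deletion Δ x
  nonvertex⇒≃deletion down x ¬Δx H =
    mk⇔ (λ ΔH → (λ x∈H → ¬Δx (down (⁅x⁆⊆p x∈H) ΔH)) , ΔH) proj₂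

  -- If x is not a vertex, Δ is its own deletion; the link decides which case holds.
  shed-downClosed : ∀ {Δ} → DownClosed Δ → ∀ x
                  → VertexDecomposable (link Δ x) → VertexDecomposable (deletion Δ x)
                  → (∀ H → IsFacet (deletion Δ x) H → IsFacet Δ H)
                  → VertexDecomposable Δ
  shed-downClosed {Δ} down x vdLink vdDeletion facets
    with nonvoid? (link-downClosed down x) vdLink
  ... | yes (_ , Δ∅∪x) = shed x (subst Δ (∪-identityˡ ⁅ x ⁆) Δ∅∪x) vdLink vdDeletion facets
  ... | no ¬link∅ =
    VertexDecomposable-resp-≃ (≃-sym (nonvertex⇒≃deletion down x ¬Δx)) vdDeletion
    where
    ¬Δx : ¬ Δ ⁅ x ⁆
    ¬Δx Δx = ¬link∅ (∉⊥ , subst Δ (sym (∪-identityˡ ⁅ x ⁆)) Δx)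

module _ {n : ℕ} (G : Graph n) where

  open CommutativeSemigroupProperties
    (CommutativeMonoid.commutativeSemigroup (∪-commutativeMonoid n))
    using (xy∙z≈xz∙y; xy∙z≈x∙zy)

  Walk-start : ∀ {S x y} → Walk G S x y → x ∈ S
  Walk-start (here x∈S) = x∈S
  Walk-start (step x∈S _ _) = x∈S

  Walk-mono : ∀ {S S′ x y} → S ⊆ S′ → Walk G S x y → Walk G S′ x y
  Walk-mono S⊆S′ (here x∈S) = here (S⊆S′ x∈S)
  Walk-mono S⊆S′ (step x∈S xz walk) = step (S⊆S′ x∈S) xz (Walk-mono S⊆S′ walk)

  Walk-++ : ∀ {S x y z} → Walk G S x y → Walk G S y z → Walk G S x z
  Walk-++ (here _) walk = walk
  Walk-++ (step x∈S xw walk₁) walk₂ = step x∈S xw (Walk-++ walk₁ walk₂)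

  Walk-snoc : ∀ {S x y z} → Walk G S x y → adj G y z ≡ true → z ∈ S → Walk G S x z
  Walk-snoc walk yz z∈S = Walk-++ walk (step (Walk-end walk) yz (here z∈S))
    where
    Walk-end : ∀ {S x y} → Walk G S x y → y ∈ S
    Walk-end (here y∈S) = y∈S
    Walk-end (step _ _ walk) = Walk-end walk

  Walk-reverse : ∀ {S x y} → Walk G S x y → Walk G S y x
  Walk-reverse (here x∈S) = here x∈S
  Walk-reverse {x = x} (step {z = z} x∈S xz walk) =
    Walk-snoc (Walk-reverse walk) (trans (adj-sym G z x) xz) x∈S

  Connected-∪⁅⁆ : ∀ {T w z} → Connected G T → w ∈ T → adj G w z ≡ true
                → Connected G (T ∪ ⁅ z ⁆)
  Connected-∪⁅⁆ {T} {w} {z} ((t , t∈T) , walks) w∈T wz =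
    (t , p⊆p∪q ⁅ z ⁆ t∈T) ,
    λ x y x∈T∪z y∈T∪z → Walk-++ (walk-to-z x∈T∪z) (Walk-reverse (walk-to-z y∈T∪z))
    where
    walk-to-z : ∀ {x} → x ∈ T ∪ ⁅ z ⁆ → Walk G (T ∪ ⁅ z ⁆) x z
    walk-to-z {x} x∈T∪z with x∈p∪q⁻ T ⁅ z ⁆ x∈T∪z
    ... | inj₁ x∈T =
      Walk-snoc (Walk-mono (p⊆p∪q ⁅ z ⁆) (walks x w x∈T w∈T)) wz (q⊆p∪q T ⁅ z ⁆ (x∈⁅x⁆ z))
    ... | inj₂ x∈⁅z⁆ rewrite x∈⁅y⁆⇒x≡y z x∈⁅z⁆ = here x∈T∪z

  LeavingEdge : Subset n → Subset n → Set
  LeavingEdge S P = ∃₂ λ w z → w ∈ P × z ∉ P × z ∈ S × adj G w z ≡ true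

  walk-leaves : ∀ {S u v} (P : Subset n) → Walk G S u v → u ∈ P → v ∉ P → LeavingEdge S P
  walk-leaves P (here _) u∈P u∉P = ⊥-elim (u∉P u∈P)
  walk-leaves P (step {z = z} _ uz walk) u∈P v∉P with z ∈? P
  ... | yes z∈P = walk-leaves P walk z∈P v∉P
  ... | no z∉P = _ , z , u∈P , z∉P , Walk-start walk , uz

  connected-extension-step : ∀ {T F F′} → Connected G T → Connected G (F ∪ T) → Disjoint F T
                           → F′ ⊆ F → ∣ F′ ∣ < ∣ F ∣ → Connected G (F′ ∪ T)
                           → ∃ λ F″ → F″ ⊆ F × ∣ F″ ∣ ≡ suc ∣ F′ ∣ × Connected G (F″ ∪ T)
  connected-extension-step {T} {F} {F′} ((t , t∈T) , _) (_ , walks) F#T F′⊆F ∣F′∣<∣F∣ cF′T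
    with ∣p∣<∣q∣⇒∃x∈q∖p F′ F ∣F′∣<∣F∣
  ... | y , y∈F , y∉F′
    with walk-leaves (F′ ∪ T) (walks t y (q⊆p∪q F T t∈T) (p⊆p∪q T y∈F))
           (q⊆p∪q F′ T t∈T) (x∉p∪q F′ T y∉F′ (F#T y∈F))
  ... | w , z , w∈F′∪T , z∉F′∪T , z∈F∪T , wz =
    F′ ∪ ⁅ z ⁆ , ∪⊆ F′⊆F (⁅x⁆⊆p z∈F) ,
    ∣p∪⁅x⁆∣≡1+∣p∣ F′ z (z∉F′∪T ∘ p⊆p∪q T) ,
    subst (Connected G) (xy∙z≈xz∙y F′ T ⁅ z ⁆) (Connected-∪⁅⁆ cF′T w∈F′∪T wz)
    where
    z∈F : z ∈ F
    z∈F = [ id , (λ z∈T → ⊥-elim (z∉F′∪T (q⊆p∪q F′ T z∈T))) ] (x∈p∪q⁻ F T z∈F∪T)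

  connected-sub-extension : ∀ {T F} → Connected G T → Connected G (F ∪ T) → Disjoint F T
                          → ∀ k → k ≤ ∣ F ∣
                          → ∃ λ F′ → F′ ⊆ F × ∣ F′ ∣ ≡ k × Connected G (F′ ∪ T)
  connected-sub-extension {T} cT _ _ zero _ =
    ∅ , ⊥⊆ , ∣⊥∣≡0 n , subst (Connected G) (sym (∪-identityˡ T)) cT
  connected-sub-extension cT cFT F#T (suc k) k<∣F∣
    with connected-sub-extension cT cFT F#T k (<⇒≤ k<∣F∣)
  ... | F′ , F′⊆F , refl , cF′T = connected-extension-step cT cFT F#T F′⊆F k<∣F∣ cF′T

  -- Σ≥_r(A,B) is CoConnected≥ r A B.  Sizes ≥ r rather than = r make the deletion
  -- of a neighbour x of A again of this shape, whether or not the support contains x.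
  record Support≥ (r : ℕ) (A B F : Subset n) : Set where
    constructor support
    field
      large     : r ≤ ∣ F ∣
      F#A       : Disjoint F A
      F#B       : Disjoint F B
      connected : Connected G (F ∪ A)
  open Support≥

  CoConnected≥ : ℕ → Subset n → Subset n → Complex n
  CoConnected≥ r A B H = ∃ λ F → Support≥ r A B F × Disjoint H F × Disjoint H A × Disjoint H B

  CoConnected≥-downClosed : ∀ {r A B} → DownClosed (CoConnected≥ r A B)
  CoConnected≥-downClosed K⊆H (F , S , H#F , H#A , H#B) =
    F , S , Disjoint-monoˡ K⊆H H#F , Disjoint-monoˡ K⊆H H#A , Disjoint-monoˡ K⊆H H#B

  CoConnected≥-zero : ∀ {A B} → Connected G A → ∀ H → CoConnected≥ 0 A B H ⇔ H ⊆ ∁ (A ∪ B)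
  CoConnected≥-zero {A} {B} cA H = mk⇔ to′ from′
    where
    to′ : CoConnected≥ 0 A B H → H ⊆ ∁ (A ∪ B)
    to′ (_ , _ , _ , H#A , H#B) = Disjoint⇒⊆∁ (Disjoint-∪ʳ H#A H#B)
    from′ : H ⊆ ∁ (A ∪ B) → CoConnected≥ 0 A B H
    from′ H⊆∁A∪B =
      ∅ , support z≤n Disjoint-∅ˡ Disjoint-∅ˡ (subst (Connected G) (sym (∪-identityˡ A)) cA) ,
      Disjoint-∅ʳ , Disjoint-monoʳ (p⊆p∪q B) H#A∪B , Disjoint-monoʳ (q⊆p∪q A B) H#A∪B
      where
      H#A∪B : Disjoint H (A ∪ B)
      H#A∪B = ⊆∁⇒Disjoint H⊆∁A∪B

  exact-subsupport : ∀ {r A B F} → Connected G A → Support≥ r A B F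
                   → ∃ λ F′ → F′ ⊆ F × ∣ F′ ∣ ≡ r × Support≥ r A B F′
  exact-subsupport {r} cA S with connected-sub-extension cA (connected S) (F#A S) r (large S)
  ... | F′ , F′⊆F , ∣F′∣≡r , cF′A =
    F′ , F′⊆F , ∣F′∣≡r ,
    support (≤-reflexive (sym ∣F′∣≡r))
            (Disjoint-monoˡ F′⊆F (F#A S)) (Disjoint-monoˡ F′⊆F (F#B S)) cF′A

  ∁-support-face : ∀ {r A B F} → Support≥ r A B F → CoConnected≥ r A B (∁ (F ∪ A ∪ B))
  ∁-support-face {A = A} {B} {F} S =
    F , S , Disjoint-monoʳ (p⊆p∪q (A ∪ B)) Disjoint-∁ ,
    Disjoint-monoʳ (q⊆p∪q F (A ∪ B) ∘ p⊆p∪q B) Disjoint-∁ ,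
    Disjoint-monoʳ (q⊆p∪q F (A ∪ B) ∘ q⊆p∪q A B) Disjoint-∁

  -- Shrinking F to a connected subsupport of size r would enlarge the face by F ∖ F′.
  supports-of-facet-are-exact : ∀ {r A B H F} → Connected G A → IsFacet (CoConnected≥ r A B) H
                              → Support≥ r A B F → Disjoint H F → ¬ r < ∣ F ∣
  supports-of-facet-are-exact {r} {A} {B} {H} {F} cA ((_ , _ , _ , H#A , H#B) , maximal)
                              S H#F r<∣F∣
    with exact-subsupport cA S
  ... | F′ , F′⊆F , ∣F′∣≡r , S′
    with ∣p∣<∣q∣⇒∃x∈q∖p F′ F (subst (_< ∣ F ∣) (sym ∣F′∣≡r) r<∣F∣)
  ... | f , f∈F , f∉F′ = H#F f∈H f∈F
    where
    H⊆H′ : H ⊆ ∁ (F′ ∪ A ∪ B)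
    H⊆H′ = Disjoint⇒⊆∁ (Disjoint-∪ʳ (Disjoint-monoʳ F′⊆F H#F) (Disjoint-∪ʳ H#A H#B))
    f∈H : f ∈ H
    f∈H = subst (f ∈_) (sym (maximal _ (∁-support-face S′) H⊆H′))
            (x∉p⇒x∈∁p (x∉p∪q F′ (A ∪ B) f∉F′ (x∉p∪q A B (F#A S f∈F) (F#B S f∈F))))

  CoConnected≥-∅≃CoConnected : ∀ {r A} → Connected G A → CoConnected≥ r A ∅ ≃ CoConnected r A G
  CoConnected≥-∅≃CoConnected {r} {A} cA H = mk⇔ to′ from′
    where
    to′ : CoConnected≥ r A ∅ H → CoConnected r A G H
    to′ (F , S , H#F , H#A , _) with exact-subsupport cA S
    ... | F′ , F′⊆F , ∣F′∣≡r , S′ =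
      F′ , (∣F′∣≡r , Disjoint⇒∩≡∅ (F#A S′) , connected S′) ,
      λ i∈H → x∈p∧x∉q⇒x∈p─q (x∉p⇒x∈∁p (H#F i∈H ∘ F′⊆F)) (H#A i∈H)
    from′ : CoConnected r A G H → CoConnected≥ r A ∅ H
    from′ (F , (∣F∣≡r , F∩A≡∅ , cFA) , H⊆∁F─A) =
      F , support (≤-reflexive (sym ∣F∣≡r)) (∩≡∅⇒Disjoint F∩A≡∅) Disjoint-∅ʳ cFA ,
      (λ i∈H → x∈∁p⇒x∉p (p─q⊆p (∁ F) A (H⊆∁F─A i∈H))) ,
      (λ i∈H → Disjoint-─ (∁ F) A (H⊆∁F─A i∈H)) ,
      Disjoint-∅ʳ

  record OuterNeighbour (A B : Subset n) (x : Fin n) : Set where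
    constructor outerNeighbour
    field
      x∉A      : x ∉ A
      x∉B      : x ∉ B
      anchor   : Fin n
      anchor∈A : anchor ∈ A
      adjacent : adj G anchor x ≡ true

  outerNeighbour? : ∀ A B → Dec (∃ (OuterNeighbour A B))
  outerNeighbour? A B =
    map′ (λ (x , x∉A , x∉B , a , a∈A , ax) → x , outerNeighbour x∉A x∉B a a∈A ax)
         (λ (x , outerNeighbour x∉A x∉B a a∈A ax) → x , x∉A , x∉B , a , a∈A , ax)
         (any? λ x → ¬? (x ∈? A) ×-dec ¬? (x ∈? B) ×-dec
                     any? λ a → (a ∈? A) ×-dec (adj G a x Bool.≟ true))

  support-outerNeighbour : ∀ {r A B F} → Nonempty A → Support≥ (suc r) A B F
                         → ∃ (OuterNeighbour A B)
  support-outerNeighbour {A = A} {B} {F} (a , a∈A) S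
    with ∣p∣<∣q∣⇒∃x∈q∖p ∅ F (subst (_< ∣ F ∣) (sym (∣⊥∣≡0 n)) (≤-trans (s≤s z≤n) (large S)))
  ... | f , f∈F , _
    with walk-leaves A (proj₂ (connected S) a f (q⊆p∪q F A a∈A) (p⊆p∪q A f∈F)) a∈A (F#A S f∈F)
  ... | w , z , w∈A , z∉A , z∈F∪A , wz = z , outerNeighbour z∉A (F#B S z∈F) w w∈A wz
    where
    z∈F : z ∈ F
    z∈F = [ id , (λ z∈A → ⊥-elim (z∉A z∈A)) ] (x∈p∪q⁻ F A z∈F∪A)

  module Shedding {A B x} (N : OuterNeighbour A B x) where
    open OuterNeighbour N

    x∈∪⁅x⁆ : ∀ {C} → x ∈ C ∪ ⁅ x ⁆
    x∈∪⁅x⁆ {C} = q⊆p∪q C ⁅ x ⁆ (x∈⁅x⁆ x)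

    link-≃ : ∀ r → link (CoConnected≥ r A B) x ≃ CoConnected≥ r A (B ∪ ⁅ x ⁆)
    link-≃ r H = mk⇔ to′ from′
      where
      to′ : link (CoConnected≥ r A B) x H → CoConnected≥ r A (B ∪ ⁅ x ⁆) H
      to′ (x∉H , F , S , H∪x#F , H∪x#A , H∪x#B) =
        F ,
        support (large S) (F#A S) (Disjoint-∪ʳ (F#B S) (Disjoint-⁅⁆ʳ (H∪x#F x∈∪⁅x⁆)))
                (connected S) ,
        Disjoint-monoˡ (p⊆p∪q ⁅ x ⁆) H∪x#F , Disjoint-monoˡ (p⊆p∪q ⁅ x ⁆) H∪x#A ,
        Disjoint-∪ʳ (Disjoint-monoˡ (p⊆p∪q ⁅ x ⁆) H∪x#B) (Disjoint-⁅⁆ʳ x∉H)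
      from′ : CoConnected≥ r A (B ∪ ⁅ x ⁆) H → link (CoConnected≥ r A B) x H
      from′ (F , S , H#F , H#A , H#B∪x) =
        (λ x∈H → H#B∪x x∈H x∈∪⁅x⁆) ,
        F , support (large S) (F#A S) (Disjoint-monoʳ (p⊆p∪q ⁅ x ⁆) (F#B S)) (connected S) ,
        Disjoint-∪ˡ H#F (Disjoint-⁅⁆ˡ (λ x∈F → F#B S x∈F x∈∪⁅x⁆)) ,
        Disjoint-∪ˡ H#A (Disjoint-⁅⁆ˡ x∉A) ,
        Disjoint-∪ˡ (Disjoint-monoʳ (p⊆p∪q ⁅ x ⁆) H#B∪x) (Disjoint-⁅⁆ˡ x∉B)

    Connected-F∪A∪x : ∀ {r F} → Support≥ r A B F → Connected G ((F ∪ A) ∪ ⁅ x ⁆)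
    Connected-F∪A∪x {F = F} S = Connected-∪⁅⁆ (connected S) (q⊆p∪q F A anchor∈A) adjacent

    support-∪x : ∀ {r F} → Support≥ (suc r) A B F → x ∉ F → Support≥ r (A ∪ ⁅ x ⁆) B F
    support-∪x {F = F} S x∉F =
      support (<⇒≤ (large S)) (Disjoint-∪ʳ (F#A S) (Disjoint-⁅⁆ʳ x∉F)) (F#B S)
              (subst (Connected G) (∪-assoc F A ⁅ x ⁆) (Connected-F∪A∪x S))

    deletion-≃ : ∀ r → deletion (CoConnected≥ (suc r) A B) x ≃ CoConnected≥ r (A ∪ ⁅ x ⁆) B
    deletion-≃ r H = mk⇔ to′ from′
      where
      to′ : deletion (CoConnected≥ (suc r) A B) x H → CoConnected≥ r (A ∪ ⁅ x ⁆) B H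
      to′ (x∉H , F , S , H#F , H#A , H#B) =
        F - x ,
        support (s≤s⁻¹ (≤-trans (large S) (∣p∣≤1+∣p-x∣ F x)))
                (Disjoint-∪ʳ (Disjoint-monoˡ (p─q⊆p F ⁅ x ⁆) (F#A S)) (Disjoint-─ F ⁅ x ⁆))
                (Disjoint-monoˡ (p─q⊆p F ⁅ x ⁆) (F#B S))
                (subst (Connected G) F∪A∪x≡F-x∪A∪x (Connected-F∪A∪x S)) ,
        Disjoint-monoʳ (p─q⊆p F ⁅ x ⁆) H#F , Disjoint-∪ʳ H#A (Disjoint-⁅⁆ʳ x∉H) , H#B
        where
        F∪A∪x≡F-x∪A∪x : (F ∪ A) ∪ ⁅ x ⁆ ≡ (F - x) ∪ (A ∪ ⁅ x ⁆)
        F∪A∪x≡F-x∪A∪x = begin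
          (F ∪ A) ∪ ⁅ x ⁆          ≡⟨ xy∙z≈xz∙y F A ⁅ x ⁆ ⟩
          (F ∪ ⁅ x ⁆) ∪ A          ≡⟨ cong (_∪ A) (p-x∪⁅x⁆≡p∪⁅x⁆ F x) ⟨
          ((F - x) ∪ ⁅ x ⁆) ∪ A    ≡⟨ xy∙z≈x∙zy (F - x) ⁅ x ⁆ A ⟩
          (F - x) ∪ (A ∪ ⁅ x ⁆)    ∎
          where open ≡-Reasoning
      from′ : CoConnected≥ r (A ∪ ⁅ x ⁆) B H → deletion (CoConnected≥ (suc r) A B) x H
      from′ (F , S , H#F , H#A∪x , H#B) =
        (λ x∈H → H#A∪x x∈H x∈∪⁅x⁆) ,
        F ∪ ⁅ x ⁆ ,
        support (subst (suc r ≤_) (sym (∣p∪⁅x⁆∣≡1+∣p∣ F x x∉F)) (s≤s (large S)))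
                (Disjoint-∪ˡ (Disjoint-monoʳ (p⊆p∪q ⁅ x ⁆) (F#A S)) (Disjoint-⁅⁆ˡ x∉A))
                (Disjoint-∪ˡ (F#B S) (Disjoint-⁅⁆ˡ x∉B))
                (subst (Connected G) (sym (xy∙z≈x∙zy F ⁅ x ⁆ A)) (connected S)) ,
        Disjoint-∪ʳ H#F (Disjoint-⁅⁆ʳ (λ x∈H → H#A∪x x∈H x∈∪⁅x⁆)) ,
        Disjoint-monoʳ (p⊆p∪q ⁅ x ⁆) H#A∪x , H#B
        where
        x∉F : x ∉ F
        x∉F x∈F = F#A S x∈F x∈∪⁅x⁆

    -- A face K ⊇ H containing x would have a support of size > r avoiding x, which is
    -- also a support of the deletion witnessing H.
    deletion-facet⇒facet : Connected G A → ∀ r H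
                         → IsFacet (deletion (CoConnected≥ (suc r) A B) x) H
                         → IsFacet (CoConnected≥ (suc r) A B) H
    deletion-facet⇒facet cA r H facet@((x∉H , ΔH) , maximal) =
      ΔH , λ K ΔK H⊆K → maximal K (x∉face K ΔK H⊆K , ΔK) H⊆K
      where
      x∉face : ∀ K → CoConnected≥ (suc r) A B K → H ⊆ K → x ∉ K
      x∉face K (F , S , K#F , _) H⊆K x∈K =
        supports-of-facet-are-exact (Connected-∪⁅⁆ cA anchor∈A adjacent)
          (IsFacet-resp-≃ (deletion-≃ r) facet) (support-∪x S (K#F x∈K))
          (Disjoint-monoˡ H⊆K K#F) (large S)

  vertexDecomposable : ∀ k r {A B} → Connected G A → ∣ ∁ (A ∪ B) ∣ < k
                     → VertexDecomposable (CoConnected≥ r A B)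
  vertexDecomposable (suc k) zero {A} {B} cA _ = simplex (∁ (A ∪ B) , CoConnected≥-zero cA)
  vertexDecomposable (suc k) (suc r) {A} {B} cA bound with outerNeighbour? A B
  ... | no none = void λ H (F , S , _) → none (support-outerNeighbour (proj₁ cA) S)
  ... | yes (x , N) =
    shed-downClosed CoConnected≥-downClosed x
      (VertexDecomposable-resp-≃ (≃-sym (link-≃ (suc r)))
        (vertexDecomposable k (suc r) cA (smaller (∪-assoc A B ⁅ x ⁆))))
      (VertexDecomposable-resp-≃ (≃-sym (deletion-≃ r))
        (vertexDecomposable k r (Connected-∪⁅⁆ cA anchor∈A adjacent)
          (smaller (xy∙z≈xz∙y A B ⁅ x ⁆))))
      (deletion-facet⇒facet cA r)
    where
    open OuterNeighbour N
    open Shedding N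
    smaller : ∀ {C} → (A ∪ B) ∪ ⁅ x ⁆ ≡ C → ∣ ∁ C ∣ < k
    smaller refl = <-≤-trans (∣∁[p∪⁅x⁆]∣<∣∁p∣ (A ∪ B) (x∉p∪q A B x∉A x∉B)) (s≤s⁻¹ bound)

theorem3p7 : (n : ℕ) (G : Graph n) (A : Subset n)
             → Nonempty A → Connected G A
             → (r : ℕ) → 1 ≤ r
             → VertexDecomposable (CoConnected r A G)
theorem3p7 n G A _ cA r _ =
  VertexDecomposable-resp-≃ (CoConnected≥-∅≃CoConnected G cA)
    (vertexDecomposable G (suc n) r cA (s≤s (∣p∣≤n (∁ (A ∪ ∅)))))
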